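{- Let $k\le l$ be positive integers with $\gcd(k,l)=1$, let $n\ge 1$ and $m\ge 0$ be integers, and write $m=qn+r$ with integers $q\ge0$, $0\le r<n$. Then there exists $A\in\mathcal D^{k,l}(m,n)$ such that ${\rm tdet}(A)\le nk(q+1)$.
   Context: $\mathcal D^{k,l}(m,n)$ denotes the set of all $nk\times nl$ matrices with nonnegative integer entries all of whose row sums equal $ml$ and all of whose column sums equal $mk$. For an $s\times t$ matrix $A$ with $s\le t$, a transversal is a set of $s$ entries of $A$, one from each row, no two in the same column; if $s>t$, the transversals of $A$ are those of its transpose. For a transversal $T$, $|T|$ is the sum of its entries. The tropical determinant is ${\rm tdet}(A)=\max_T |T|$ over all transversals $T$ of $A$. -}

module Defs where

open import Data.Nat using (ℕ; _+_; _*_; _≤_)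
open import Data.Fin using (Fin)
open import Function.Definitions using (Injective)
open import Relation.Binary.PropositionalEquality using (_≡_)
open import Data.Vec.Functional using (Vector)
open import Data.Vec.Functional using () renaming (foldr to vfoldr)

Matrix : ℕ → ℕ → Set
Matrix s t = Fin s → Fin t → ℕ

Σ : {n : ℕ} → Vector ℕ n → ℕ
Σ v = vfoldr _+_ 0 v

rowSum : {s t : ℕ} → Matrix s t → Fin s → ℕ
rowSum A i = Σ (λ j → A i j)

colSum : {s t : ℕ} → Matrix s t → Fin t → ℕ
colSum A j = Σ (λ i → A i j)

-- A ∈ D^{k,l}(m,n): an nk × nl matrix over ℕ with all row sums ml
-- and all column sums mk.
InD : (k l m n : ℕ) → Matrix (n * k) (n * l) → Set
InD k l m n A = (∀ i → rowSum A i ≡ m * l) × (∀ j → colSum A j ≡ m * k)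
  where open import Data.Product using (_×_)

-- A transversal of an s × t matrix with s ≤ t: one entry from each row,
-- no two in the same column, i.e. an injective choice of column per row.
record Transversal (s t : ℕ) : Set where
  field
    col : Fin s → Fin t
    inj : Injective _≡_ _≡_ col

weight : {s t : ℕ} → Matrix s t → Transversal s t → ℕ
weight A T = Σ (λ i → A i (Transversal.col T i))

-- For s ≤ t, tdet(A) = max_T |T|; "tdet(A) ≤ b" unfolds to: every
-- transversal has weight ≤ b (the set of transversals is nonempty as s ≤ t).
TdetAtMost : {s t : ℕ} → Matrix s t → ℕ → Set
TdetAtMost A b = ∀ (T : Transversal _ _) → weight A T ≤ b

module Submission where

-- The witness is a block matrix.  Let N = n, K = k, L = l and let C be
-- the N × N circulant
--     C a c = q + [ (a + c) mod N < r ],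
-- every row and column of which sums to qN + r = m, since (a + c) mod N
-- runs through 0, …, N-1 exactly once as c does.  Inflating every entry
-- of C to a K × L block of copies gives an NK × NL matrix A whose row
-- sums are L·m and column sums K·m, so A ∈ D^{k,l}(m,n).  Every entry of
-- A is at most q + 1, so every transversal (NK entries) weighs at most
-- NK(q + 1), which is the bound on tdet(A).

open import Defs
open import Data.Nat using (ℕ; suc; _+_; _*_; _≤_; _<_)
open import Data.Nat.GCD using (gcd)
open import Data.Product using (Σ-syntax; _×_)
open import Relation.Binary.PropositionalEquality using (_≡_)

open import Data.Nat using (zero; z≤n; s≤s; NonZero; _∸_)
open import Data.Nat.Properties
open import Data.Nat.DivMod
open import Data.Fin using (Fin; toℕ) renaming (zero to fzero; suc to fsuc)
open import Data.Product using (_,_)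
open import Function using (_∘_)
open import Algebra.Properties.CommutativeSemigroup +-commutativeSemigroup
  using () renaming (interchange to +-interchange)
open import Relation.Binary.PropositionalEquality
  using (refl; sym; trans; cong; cong₂; module ≡-Reasoning)

sumTo : (ℕ → ℕ) → ℕ → ℕ
sumTo g zero    = 0
sumTo g (suc n) = g 0 + sumTo (g ∘ suc) n

Σ-toℕ : ∀ n (g : ℕ → ℕ) → Σ {n} (g ∘ toℕ) ≡ sumTo g n
Σ-toℕ zero    g = refl
Σ-toℕ (suc n) g = cong (g 0 +_) (Σ-toℕ n (g ∘ suc))

sumTo-cong : ∀ n {f g : ℕ → ℕ} → (∀ x → x < n → f x ≡ g x) →
             sumTo f n ≡ sumTo g n
sumTo-cong zero    eq = refl
sumTo-cong (suc n) eq =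
  cong₂ _+_ (eq 0 (s≤s z≤n)) (sumTo-cong n (λ x x<n → eq (suc x) (s≤s x<n)))

sumTo-const : ∀ n c → sumTo (λ _ → c) n ≡ n * c
sumTo-const zero    c = refl
sumTo-const (suc n) c = cong (c +_) (sumTo-const n c)

sumTo-+const : ∀ n c (g : ℕ → ℕ) → sumTo (λ x → c + g x) n ≡ n * c + sumTo g n
sumTo-+const zero    c g = refl
sumTo-+const (suc n) c g =
  trans (cong (c + g 0 +_) (sumTo-+const n c (g ∘ suc))) (+-interchange c (g 0) (n * c) _)

sumTo-split : ∀ a b (f : ℕ → ℕ) → sumTo f (a + b) ≡ sumTo f a + sumTo (λ x → f (a + x)) b
sumTo-split zero    b f = refl
sumTo-split (suc a) b f =
  trans (cong (f 0 +_) (sumTo-split a b (f ∘ suc))) (sym (+-assoc (f 0) _ _))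

sumTo-last : ∀ n (g : ℕ → ℕ) → sumTo g (suc n) ≡ sumTo g n + g n
sumTo-last zero    g = +-comm (g 0) 0
sumTo-last (suc n) g =
  trans (cong (g 0 +_) (sumTo-last n (g ∘ suc))) (sym (+-assoc (g 0) _ _))

sumTo-rotate : ∀ n (g : ℕ → ℕ) → g n ≡ g 0 → sumTo (g ∘ suc) n ≡ sumTo g n
sumTo-rotate n g gn≡g0 = +-cancelˡ-≡ (g 0) _ _ (begin
    g 0 + sumTo (g ∘ suc) n
  ≡⟨ sumTo-last n g ⟩
    sumTo g n + g n
  ≡⟨ cong (sumTo g n +_) gn≡g0 ⟩
    sumTo g n + g 0
  ≡⟨ +-comm (sumTo g n) (g 0) ⟩
    g 0 + sumTo g n ∎)
  where open ≡-Reasoning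

sumTo-periodic : ∀ n (f : ℕ → ℕ) → (∀ x → f (x + n) ≡ f x) →
                 ∀ a → sumTo (λ c → f (a + c)) n ≡ sumTo f n
sumTo-periodic n f period zero    = refl
sumTo-periodic n f period (suc a) = begin
    sumTo (λ c → f (suc a + c)) n
  ≡⟨ sumTo-cong n (λ c _ → cong f (sym (+-suc a c))) ⟩
    sumTo (λ c → f (a + suc c)) n
  ≡⟨ sumTo-rotate n (λ c → f (a + c)) (trans (period a) (cong f (sym (+-identityʳ a)))) ⟩
    sumTo (λ c → f (a + c)) n
  ≡⟨ sumTo-periodic n f period a ⟩
    sumTo f n ∎
  where open ≡-Reasoning

sumTo-inflate : ∀ n L .{{_ : NonZero L}} (h : ℕ → ℕ) →
                sumTo (λ y → h (y / L)) (n * L) ≡ L * sumTo h n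
sumTo-inflate zero    L h = sym (*-zeroʳ L)
sumTo-inflate (suc n) L h = begin
    sumTo (λ y → h (y / L)) (L + n * L)
  ≡⟨ sumTo-split L (n * L) _ ⟩
    sumTo (λ y → h (y / L)) L + sumTo (λ y → h ((L + y) / L)) (n * L)
  ≡⟨ cong₂ _+_ firstBlock rest ⟩
    L * h 0 + L * sumTo (h ∘ suc) n
  ≡⟨ sym (*-distribˡ-+ L (h 0) _) ⟩
    L * sumTo h (suc n) ∎
  where
  open ≡-Reasoning
  firstBlock : sumTo (λ y → h (y / L)) L ≡ L * h 0
  firstBlock = trans (sumTo-cong L (λ y y<L → cong h (m<n⇒m/n≡0 y<L))) (sumTo-const L (h 0))
  [L+y]/L : ∀ y → (L + y) / L ≡ suc (y / L)
  [L+y]/L y = trans (m/n≡1+[m∸n]/n (m≤m+n L y)) (cong (λ z → suc (z / L)) (m+n∸m≡n L y))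
  rest : sumTo (λ y → h ((L + y) / L)) (n * L) ≡ L * sumTo (h ∘ suc) n
  rest = trans (sumTo-cong (n * L) (λ y _ → cong h ([L+y]/L y))) (sumTo-inflate n L (h ∘ suc))

Σ-≤ : ∀ n (v : Fin n → ℕ) c → (∀ i → v i ≤ c) → Σ v ≤ n * c
Σ-≤ zero    v c v≤c = z≤n
Σ-≤ (suc n) v c v≤c = +-mono-≤ (v≤c fzero) (Σ-≤ n (v ∘ fsuc) c (v≤c ∘ fsuc))

below : ℕ → ℕ → ℕ
below x       zero    = 0
below zero    (suc r) = 1
below (suc x) (suc r) = below x r

below≤1 : ∀ x r → below x r ≤ 1
below≤1 x       zero    = z≤n
below≤1 zero    (suc r) = s≤s z≤n
below≤1 (suc x) (suc r) = below≤1 x r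

sumTo-below : ∀ r d → sumTo (λ x → below x r) (r + d) ≡ r
sumTo-below zero    d = trans (sumTo-const d 0) (*-zeroʳ d)
sumTo-below (suc r) d = cong suc (sumTo-below r d)

sumTo-below-mod : ∀ n .{{_ : NonZero n}} r → r < n → ∀ a →
                  sumTo (λ c → below ((a + c) % n) r) n ≡ r
sumTo-below-mod n r r<n a = begin
    sumTo (λ c → below ((a + c) % n) r) n
  ≡⟨ sumTo-periodic n (λ x → below (x % n) r) (λ x → cong (λ z → below z r) ([m+n]%n≡m%n x n)) a ⟩
    sumTo (λ c → below (c % n) r) n
  ≡⟨ sumTo-cong n (λ c c<n → cong (λ z → below z r) (m<n⇒m%n≡m c<n)) ⟩
    sumTo (λ c → below c r) n
  ≡⟨ cong (sumTo (λ c → below c r)) (sym (m+[n∸m]≡n (<⇒≤ r<n))) ⟩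
    sumTo (λ c → below c r) (r + (n ∸ r))
  ≡⟨ sumTo-below r (n ∸ r) ⟩
    r ∎
  where open ≡-Reasoning

circulant : (n : ℕ) .{{_ : NonZero n}} → ℕ → ℕ → ℕ → ℕ → ℕ
circulant n q r a c = q + below ((a + c) % n) r

circulant-sym : ∀ n .{{_ : NonZero n}} q r a c → circulant n q r a c ≡ circulant n q r c a
circulant-sym n q r a c = cong (λ z → q + below (z % n) r) (+-comm a c)

circulant≤ : ∀ n .{{_ : NonZero n}} q r a c → circulant n q r a c ≤ q + 1
circulant≤ n q r a c = +-monoʳ-≤ q (below≤1 ((a + c) % n) r)

circulant-rowSum : ∀ n .{{_ : NonZero n}} q r → r < n → ∀ a →
                   sumTo (circulant n q r a) n ≡ q * n + r
circulant-rowSum n q r r<n a = begin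
    sumTo (λ c → q + below ((a + c) % n) r) n
  ≡⟨ sumTo-+const n q _ ⟩
    n * q + sumTo (λ c → below ((a + c) % n) r) n
  ≡⟨ cong₂ _+_ (*-comm n q) (sumTo-below-mod n r r<n a) ⟩
    q * n + r ∎
  where open ≡-Reasoning

inflate : ∀ n K L .{{_ : NonZero K}} .{{_ : NonZero L}} →
          (ℕ → ℕ → ℕ) → Matrix (n * K) (n * L)
inflate n K L B i j = B (toℕ i / K) (toℕ j / L)

inflate-rowSum : ∀ n K L .{{_ : NonZero K}} .{{_ : NonZero L}} (B : ℕ → ℕ → ℕ) s →
                 (∀ a → sumTo (B a) n ≡ s) → ∀ i → rowSum (inflate n K L B) i ≡ s * L
inflate-rowSum n K L B s rows i = begin
    rowSum (inflate n K L B) i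
  ≡⟨ Σ-toℕ (n * L) (λ y → B (toℕ i / K) (y / L)) ⟩
    sumTo (λ y → B (toℕ i / K) (y / L)) (n * L)
  ≡⟨ sumTo-inflate n L (B (toℕ i / K)) ⟩
    L * sumTo (B (toℕ i / K)) n
  ≡⟨ cong (L *_) (rows (toℕ i / K)) ⟩
    L * s
  ≡⟨ *-comm L s ⟩
    s * L ∎
  where open ≡-Reasoning

inflate-colSum : ∀ n K L .{{_ : NonZero K}} .{{_ : NonZero L}} (B : ℕ → ℕ → ℕ) s →
                 (∀ c → sumTo (λ a → B a c) n ≡ s) → ∀ j → colSum (inflate n K L B) j ≡ s * K
inflate-colSum n K L B s cols j = begin
    colSum (inflate n K L B) j
  ≡⟨ Σ-toℕ (n * K) (λ x → B (x / K) (toℕ j / L)) ⟩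
    sumTo (λ x → B (x / K) (toℕ j / L)) (n * K)
  ≡⟨ sumTo-inflate n K (λ a → B a (toℕ j / L)) ⟩
    K * sumTo (λ a → B a (toℕ j / L)) n
  ≡⟨ cong (K *_) (cols (toℕ j / L)) ⟩
    K * s
  ≡⟨ *-comm K s ⟩
    s * K ∎
  where open ≡-Reasoning

tdet≤ : ∀ {s t} (A : Matrix s t) b → (∀ i j → A i j ≤ b) → TdetAtMost A (s * b)
tdet≤ {s} A b A≤b T = Σ-≤ s (λ i → A i (Transversal.col T i)) b (λ i → A≤b i _)

mainTheorem3 : (k l n m q r : ℕ) → 1 ≤ k → k ≤ l → gcd k l ≡ 1 → 1 ≤ n →
    m ≡ q * n + r → r < n →
    Σ[ A ∈ Matrix (n * k) (n * l) ] (InD k l m n A × TdetAtMost A (n * k * (q + 1)))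
mainTheorem3 (suc k) (suc l) (suc n) m q r _ _ _ _ refl r<n =
  A , (rows , cols) , tdet≤ A (q + 1) (λ i j →
    circulant≤ N q r (toℕ i / suc k) (toℕ j / suc l))
  where
  N = suc n
  C : ℕ → ℕ → ℕ
  C = circulant N q r
  A : Matrix (N * suc k) (N * suc l)
  A = inflate N (suc k) (suc l) C
  rows : ∀ i → rowSum A i ≡ (q * N + r) * suc l
  rows = inflate-rowSum N (suc k) (suc l) C _ (circulant-rowSum N q r r<n)
  cols : ∀ j → colSum A j ≡ (q * N + r) * suc k
  cols = inflate-colSum N (suc k) (suc l) C _ (λ c →
    trans (sumTo-cong N (λ a _ → circulant-sym N q r a c)) (circulant-rowSum N q r r<n c))
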